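{- Let $(h,n)=(3,3)$ and $p\in\mathcal{P}$. Then: (i) The following are equivalent: (a) the alternatives $p_1(1),p_2(1),p_3(1)$ ranked first by the three individuals are pairwise distinct, and the alternatives $p_1(3),p_2(3),p_3(3)$ ranked third are pairwise distinct; (b) $\Gamma_2(p)$ is a $3$-cycle. Moreover, if either of these conditions holds, then the arc set of $\Gamma_3(p)$ is empty. (ii) $\mu(p)=\mu(p^r)$.
   Context: $N=\{1,2,3\}$, $H=\{1,2,3\}$, $\mathcal{P}=\mathcal{L}(N)^3$ the set of profiles of linear orders on $N$; $p_i(k)$ denotes the alternative ranked in position $k$ by individual $i$; $x>_{p_i}y$ means individual $i$ ranks $x$ above $y$; $p^r$ reverses each individual's order. For $\mu\in\{2,3\}$, $\Gamma_\mu(p)$ is the directed graph on $N$ with arcs $(x,y)$ whenever $|\{i:x>_{p_i}y\}|\ge\mu$; $D_\mu(p)=\{x\in N:\forall y,\ |\{i: y>_{p_i}x\}|<\mu\}$; $\mu(p)=\min\{\mu\in\{2,3\}: D_\mu(p)\ne\varnothing\}$. A $3$-cycle is a graph on three vertices $x_1,x_2,x_3$ with arc set exactly $\{(x_1,x_2),(x_2,x_3),(x_3,x_1)\}$. -}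

module Defs where

open import Data.Nat using (ℕ; _≤_; _<_)
open import Data.Fin using (Fin; opposite) renaming (_<_ to _<ᶠ_)
open import Data.Fin.Properties using (any?; opposite-involutive) renaming (_<?_ to _<ᶠ?_)
open import Data.Fin.Properties using (_≟_)
open import Data.List using (List; length; filter; allFin)
open import Data.Product using (Σ; ∃; _×_; _,_)
open import Data.Sum using (_⊎_)
open import Relation.Binary.PropositionalEquality using (_≡_; cong; trans; sym)
open import Relation.Nullary using (Dec; ¬_)
open import Relation.Nullary.Decidable using (_×-dec_)
open import Function.Definitions using (Injective)

-- Alternatives N = {1,2,3} and individuals H = {1,2,3}, both encoded as Fin 3
-- (Fin 3 element 0 is "1", etc.).  Positions 1,2,3 are likewise Fin 3.
Alt : Set
Alt = Fin 3

Ind : Set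
Ind = Fin 3

-- A linear order on N, given by p(k) = alternative ranked in position k;
-- the map position ↦ alternative must be injective (hence a bijection).
record LinOrder : Set where
  constructor mkLin
  field
    at  : Fin 3 → Alt
    inj : Injective _≡_ _≡_ at
open LinOrder public

Profile : Set
Profile = Ind → LinOrder

Above : LinOrder → Alt → Alt → Set
Above o x y = ∃ λ k → ∃ λ l → k <ᶠ l × at o k ≡ x × at o l ≡ y

Above? : (o : LinOrder) (x y : Alt) → Dec (Above o x y)
Above? o x y = any? λ k → any? λ l → (k <ᶠ? l) ×-dec ((at o k ≟ x) ×-dec (at o l ≟ y))

support : Profile → Alt → Alt → ℕ
support p x y = length (filter (λ i → Above? (p i) x y) (allFin 3))

Arc : ℕ → Profile → Alt → Alt → Set
Arc μ p x y = μ ≤ support p x y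

InD : ℕ → Profile → Alt → Set
InD μ p x = ∀ y → support p y x < μ

DNonEmpty : ℕ → Profile → Set
DNonEmpty μ p = ∃ λ x → InD μ p x

InTwoThree : ℕ → Set
InTwoThree m = (m ≡ 2) ⊎ (m ≡ 3)

IsMu : Profile → ℕ → Set
IsMu p m = InTwoThree m × DNonEmpty m p
           × (∀ m′ → InTwoThree m′ → m′ < m → ¬ DNonEmpty m′ p)

revLin : LinOrder → LinOrder
revLin o = mkLin (λ k → at o (opposite k))
                 (λ {a} {b} e → trans (sym (opposite-involutive a))
                                  (trans (cong opposite (inj o e)) (opposite-involutive b)))

rev : Profile → Profile
rev p i = revLin (p i)

DistinctAt : Profile → Fin 3 → Set
DistinctAt p k = ∀ i j → ¬ i ≡ j → ¬ at (p i) k ≡ at (p j) k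

IsThreeCycle : ℕ → Profile → Set
IsThreeCycle μ p = ∃ λ x₁ → ∃ λ x₂ → ∃ λ x₃ →
  (¬ x₁ ≡ x₂) × (¬ x₂ ≡ x₃) × (¬ x₁ ≡ x₃) ×
  (∀ x y → (Arc μ p x y → ((x ≡ x₁ × y ≡ x₂) ⊎ (x ≡ x₂ × y ≡ x₃) ⊎ (x ≡ x₃ × y ≡ x₁)))
         × (((x ≡ x₁ × y ≡ x₂) ⊎ (x ≡ x₂ × y ≡ x₃) ⊎ (x ≡ x₃ × y ≡ x₁)) → Arc μ p x y))

module Submission where

open import Defs
open import Data.Nat using (ℕ; _≤_; _<_; _≤?_; _<?_; s≤s)
open import Data.Fin using (Fin; zero; suc; #_)
open import Data.Fin.Properties using (_≟_; all?; any?)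
open import Data.List using (length; allFin)
open import Data.List.Properties using (filter-≐; filter-notAll)
open import Data.List.Relation.Unary.Any using (here)
open import Data.Product using (_×_; _,_; ∃; proj₁; proj₂)
open import Data.Sum using (_⊎_; inj₁; inj₂)
open import Function using (_∘_)
open import Function.Bundles using (_⇔_; mk⇔; Equivalence)
open import Function.Definitions using (Injective)
open import Relation.Nullary using (¬_; Dec; ¬?)
open import Relation.Nullary.Decidable using (_×-dec_; _⊎-dec_; _→-dec_; toWitness)
open import Relation.Binary.PropositionalEquality using (_≡_; _≗_; refl; sym; trans; cong; subst)

-- Every notion in the statement depends on a profile only through the table
-- i, k ↦ p_i(k).  There are 6 linear orders on N, hence 6³ such tables, and on
-- each of them part (i) and the equivalence D₂(p) ≠ ∅ ⇔ D₂(pʳ) ≠ ∅ are decided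
-- by evaluation.  Part (ii) follows from that equivalence because D₃(p) is
-- never empty (the top alternative of individual 1 is not unanimously beaten),
-- so μ(p) = 2 or 3 according as D₂(p) is nonempty or empty.

table : Alt → Alt → Alt → Fin 3 → Alt
table a b c zero             = a
table a b c (suc zero)       = b
table a b c (suc (suc zero)) = c

perm : Fin 6 → Fin 3 → Alt
perm zero                            = table (# 0) (# 1) (# 2)
perm (suc zero)                      = table (# 0) (# 2) (# 1)
perm (suc (suc zero))                = table (# 1) (# 0) (# 2)
perm (suc (suc (suc zero)))          = table (# 1) (# 2) (# 0)
perm (suc (suc (suc (suc zero))))    = table (# 2) (# 0) (# 1)
perm (suc (suc (suc (suc (suc _))))) = table (# 2) (# 1) (# 0)

perm-injective : ∀ s → Injective _≡_ _≡_ (perm s)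
perm-injective s {k} {l} = toWitness {a? = all? λ s → all? λ k → all? λ l →
  (perm s k ≟ perm s l) →-dec (k ≟ l)} _ s k l

permOrder : Fin 6 → LinOrder
permOrder s = mkLin (perm s) (perm-injective s)

table-perm : ∀ a b c → ¬ a ≡ b → ¬ b ≡ c → ¬ a ≡ c → ∃ λ s → table a b c ≗ perm s
table-perm = toWitness {a? = all? λ a → all? λ b → all? λ c →
  ¬? (a ≟ b) →-dec ¬? (b ≟ c) →-dec ¬? (a ≟ c) →-dec
  any? λ s → all? λ k → table a b c k ≟ perm s k} _

linOrder-perm : ∀ o → ∃ λ s → at o ≗ perm s
linOrder-perm o =
  let (s , table≗perm) = table-perm (at o (# 0)) (at o (# 1)) (at o (# 2))
                                    (distinct λ ()) (distinct λ ()) (distinct λ ())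
  in s , λ k → trans (at≗table k) (table≗perm k)
  where
  distinct : ∀ {k l} → ¬ k ≡ l → ¬ at o k ≡ at o l
  distinct k≢l = k≢l ∘ inj o
  at≗table : at o ≗ table (at o (# 0)) (at o (# 1)) (at o (# 2))
  at≗table zero             = refl
  at≗table (suc zero)       = refl
  at≗table (suc (suc zero)) = refl

record _≈_ (p q : Profile) : Set where
  constructor mk≈
  field at-≗ : ∀ i → at (p i) ≗ at (q i)
open _≈_

≈-sym : ∀ {p q} → p ≈ q → q ≈ p
≈-sym E = mk≈ λ i k → sym (at-≗ E i k)

rev-cong : ∀ {p q} → p ≈ q → rev p ≈ rev q
rev-cong E = mk≈ λ i k → at-≗ E i _

Respects≈ : (Profile → Set) → Set
Respects≈ P = ∀ {p q} → p ≈ q → P p → P q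

→-respects : ∀ {P Q} → Respects≈ P → Respects≈ Q → Respects≈ (λ p → P p → Q p)
→-respects P-resp Q-resp E f = Q-resp E ∘ f ∘ P-resp (≈-sym E)

×-respects : ∀ {P Q} → Respects≈ P → Respects≈ Q → Respects≈ (λ p → P p × Q p)
×-respects P-resp Q-resp E (x , y) = P-resp E x , Q-resp E y

Above-cong : ∀ {o o′ x y} → at o ≗ at o′ → Above o x y → Above o′ x y
Above-cong E (k , l , k<l , refl , refl) = k , l , k<l , sym (E k) , sym (E l)

support-cong : ∀ {p q} → p ≈ q → ∀ x y → support p x y ≡ support q x y
support-cong {p} {q} E x y = cong length (filter-≐ (λ i → Above? (p i) x y) (λ i → Above? (q i) x y)
  ((λ {i} → Above-cong {p i} {q i} {x} {y} (at-≗ E i)) ,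
   (λ {i} → Above-cong {q i} {p i} {x} {y} (at-≗ (≈-sym E) i))) (allFin 3))

Arc-respects : ∀ μ x y → Respects≈ (λ p → Arc μ p x y)
Arc-respects μ x y E = subst (μ ≤_) (support-cong E x y)

DistinctAt-respects : ∀ k → Respects≈ (λ p → DistinctAt p k)
DistinctAt-respects k E d i j i≢j eq = d i j i≢j (trans (at-≗ E i k) (trans eq (sym (at-≗ E j k))))

IsThreeCycle-respects : ∀ μ → Respects≈ (IsThreeCycle μ)
IsThreeCycle-respects μ E (x₁ , x₂ , x₃ , d₁₂ , d₂₃ , d₁₃ , arcs) = x₁ , x₂ , x₃ , d₁₂ , d₂₃ , d₁₃ ,
  λ x y → let (arc⇒cyc , cyc⇒arc) = arcs x y in
    arc⇒cyc ∘ Arc-respects μ x y (≈-sym E) , Arc-respects μ x y E ∘ cyc⇒arc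

DNonEmpty-respects : ∀ μ → Respects≈ (DNonEmpty μ)
DNonEmpty-respects μ E (x , undominated) = x , λ y → subst (_< μ) (support-cong E y x) (undominated y)

profile : Fin 6 → Fin 6 → Fin 6 → Profile
profile a b c zero             = permOrder a
profile a b c (suc zero)       = permOrder b
profile a b c (suc (suc zero)) = permOrder c

profile-complete : ∀ p → ∃ λ a → ∃ λ b → ∃ λ c → p ≈ profile a b c
profile-complete p = proj₁ (linOrder-perm (p (# 0))) , proj₁ (linOrder-perm (p (# 1))) ,
  proj₁ (linOrder-perm (p (# 2))) , mk≈ λ where
    zero             → proj₂ (linOrder-perm (p (# 0)))
    (suc zero)       → proj₂ (linOrder-perm (p (# 1)))
    (suc (suc zero)) → proj₂ (linOrder-perm (p (# 2)))

DistinctExtremes : Profile → Set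
DistinctExtremes p = DistinctAt p (# 0) × DistinctAt p (# 2)

NoArc : ℕ → Profile → Set
NoArc μ p = ∀ x y → ¬ Arc μ p x y

CheckedFacts : Profile → Set
CheckedFacts p = (DistinctExtremes p → IsThreeCycle 2 p) × (IsThreeCycle 2 p → DistinctExtremes p)
               × (DistinctExtremes p → NoArc 3 p)
               × (DNonEmpty 2 p → DNonEmpty 2 (rev p)) × (DNonEmpty 2 (rev p) → DNonEmpty 2 p)

CheckedFacts-respects : Respects≈ CheckedFacts
CheckedFacts-respects =
  ×-respects (→-respects extremes cycle) (×-respects (→-respects cycle extremes)
  (×-respects (→-respects extremes noArc) (×-respects (→-respects D₂ D₂ʳ) (→-respects D₂ʳ D₂))))
  where
  extremes : Respects≈ DistinctExtremes
  extremes = ×-respects (DistinctAt-respects (# 0)) (DistinctAt-respects (# 2))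
  cycle : Respects≈ (IsThreeCycle 2)
  cycle = IsThreeCycle-respects 2
  noArc : Respects≈ (NoArc 3)
  noArc E none x y = none x y ∘ Arc-respects 3 x y (≈-sym E)
  D₂ : Respects≈ (DNonEmpty 2)
  D₂ = DNonEmpty-respects 2
  D₂ʳ : Respects≈ (DNonEmpty 2 ∘ rev)
  D₂ʳ = DNonEmpty-respects 2 ∘ rev-cong

Arc? : ∀ μ p x y → Dec (Arc μ p x y)
Arc? μ p x y = μ ≤? support p x y

DistinctAt? : ∀ p k → Dec (DistinctAt p k)
DistinctAt? p k = all? λ i → all? λ j → ¬? (i ≟ j) →-dec ¬? (at (p i) k ≟ at (p j) k)

IsThreeCycle? : ∀ μ p → Dec (IsThreeCycle μ p)
IsThreeCycle? μ p = any? λ x₁ → any? λ x₂ → any? λ x₃ →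
  ¬? (x₁ ≟ x₂) ×-dec ¬? (x₂ ≟ x₃) ×-dec ¬? (x₁ ≟ x₃) ×-dec
  all? λ x → all? λ y →
    let cyclic? = ((x ≟ x₁) ×-dec (y ≟ x₂)) ⊎-dec ((x ≟ x₂) ×-dec (y ≟ x₃)) ⊎-dec ((x ≟ x₃) ×-dec (y ≟ x₁))
    in (Arc? μ p x y →-dec cyclic?) ×-dec (cyclic? →-dec Arc? μ p x y)

DNonEmpty? : ∀ μ p → Dec (DNonEmpty μ p)
DNonEmpty? μ p = any? λ x → all? λ y → support p y x <? μ

CheckedFacts? : ∀ p → Dec (CheckedFacts p)
CheckedFacts? p =
  (extremes? →-dec IsThreeCycle? 2 p) ×-dec (IsThreeCycle? 2 p →-dec extremes?)
  ×-dec (extremes? →-dec all? λ x → all? λ y → ¬? (Arc? 3 p x y))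
  ×-dec (DNonEmpty? 2 p →-dec DNonEmpty? 2 (rev p)) ×-dec (DNonEmpty? 2 (rev p) →-dec DNonEmpty? 2 p)
  where
  extremes? : Dec (DistinctExtremes p)
  extremes? = DistinctAt? p (# 0) ×-dec DistinctAt? p (# 2)

checkedFacts : ∀ p → CheckedFacts p
checkedFacts p = let (a , b , c , p≈abc) = profile-complete p in
  CheckedFacts-respects (≈-sym p≈abc)
    (toWitness {a? = all? λ a → all? λ b → all? λ c → CheckedFacts? (profile a b c)} _ a b c)

top-undominated : ∀ o y → ¬ Above o y (at o (# 0))
top-undominated o y (k , l , k<l , _ , at-l≡top) with inj o at-l≡top
top-undominated o y (k , .zero , () , _ , _) | refl

D₃-nonempty : ∀ p → DNonEmpty 3 p
D₃-nonempty p = at (p (# 0)) (# 0) , λ y →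
  filter-notAll (λ i → Above? (p i) y (at (p (# 0)) (# 0))) (allFin 3) (here (top-undominated (p (# 0)) y))

IsMu-transfer : ∀ {p q} → (DNonEmpty 2 p ⇔ DNonEmpty 2 q) → ∀ m → IsMu p m → IsMu q m
IsMu-transfer D₂⇔ m (inj₁ refl , D₂p , _) =
  inj₁ refl , Equivalence.to D₂⇔ D₂p , λ { _ (inj₁ refl) (s≤s (s≤s ())) ; _ (inj₂ refl) (s≤s (s≤s ())) }
IsMu-transfer {q = q} D₂⇔ m (inj₂ refl , _ , minimal) =
  inj₂ refl , D₃-nonempty q , λ { _ (inj₁ refl) 2<3 D₂q → minimal 2 (inj₁ refl) 2<3 (Equivalence.from D₂⇔ D₂q)
                               ; _ (inj₂ refl) (s≤s (s≤s (s≤s ()))) }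

lemma25 : (p : Profile) →
    (((DistinctAt p (# 0) × DistinctAt p (# 2)) ⇔ IsThreeCycle 2 p)
     × ((DistinctAt p (# 0) × DistinctAt p (# 2)) ⊎ IsThreeCycle 2 p →
          ∀ x y → ¬ Arc 3 p x y))
    × (∀ (m : ℕ) → IsMu p m ⇔ IsMu (rev p) m)
lemma25 p =
  let (extremes⇒cycle , cycle⇒extremes , extremes⇒noArc₃ , D₂⇒D₂ʳ , D₂ʳ⇒D₂) = checkedFacts p in
  (mk⇔ extremes⇒cycle cycle⇒extremes ,
   λ { (inj₁ extremes) → extremes⇒noArc₃ extremes ; (inj₂ cycle) → extremes⇒noArc₃ (cycle⇒extremes cycle) }) ,
  λ m → mk⇔ (IsMu-transfer {p} {rev p} (mk⇔ D₂⇒D₂ʳ D₂ʳ⇒D₂) m) (IsMu-transfer {rev p} {p} (mk⇔ D₂ʳ⇒D₂ D₂⇒D₂ʳ) m)
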